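{- Let $\mathcal{P}$ and $\mathcal{Q}$ be ranked finite posets, each with a minimum and maximum element. Then $\mathcal{J}(\mathcal{P}\times\mathcal{Q},t)=\mathcal{J}(\mathcal{P},t)\,\mathcal{J}(\mathcal{Q},t)$.
   Context: For a ranked finite poset $\mathcal{S}$ with minimum $\hat0$, maximum $\hat1$ and rank function $\mathrm{rk}$ (with $\mathrm{rk}(\hat0)=0$, $\mathrm{rk}(\mathcal{S})=\mathrm{rk}(\hat1)$), the $J$-characteristic polynomial is $\mathcal{J}(\mathcal{S},t)=(-1)^{\mathrm{rk}(\mathcal{S})}\sum_{x\in\mathcal{S}}J(\hat0,x,\hat1)\,t^{\mathrm{rk}(\mathcal{S})-\mathrm{rk}(x)}$, where $J$ is defined on triples $x\le y\le z$ by $\sum_{x\le a\le y\le b\le z}J(a,y,b)=\delta_3(x,y,z)$, $\delta_3(x,y,z)=1$ iff $x=y=z$ (else $0$). The product poset $\mathcal{P}\times\mathcal{Q}$ has the componentwise order and rank $\mathrm{rk}(p,q)=\mathrm{rk}(p)+\mathrm{rk}(q)$. -}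

module Defs where

open import Data.Bool using (Bool; true; false; _∧_; not; if_then_else_)
open import Data.Nat as ℕ using (ℕ; zero; suc)
open import Data.Integer as ℤ using (ℤ; +_; -_; _-_)
open import Data.List using (List; []; _∷_; foldr; map; filter; length; cartesianProduct; upTo)
open import Data.List.Membership.Propositional using (_∈_)
open import Data.List.Relation.Unary.Unique.Propositional using (Unique)
open import Data.Product using (_×_; _,_; proj₁; proj₂)
open import Relation.Binary.PropositionalEquality using (_≡_)
open import Data.Empty using (⊥)
open import Relation.Nullary using (Dec; does; ¬_)

record RawFinPoset : Set₁ where
  field
    Carrier : Set
    elems   : List Carrier
    _≤_     : Carrier → Carrier → Set
    _≤?_    : (x y : Carrier) → Dec (x ≤ y)
    bot     : Carrier
    top     : Carrier
    rk      : Carrier → ℕ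

  _≤ᵇ_ : Carrier → Carrier → Bool
  x ≤ᵇ y = does (x ≤? y)

  _==_ : Carrier → Carrier → Bool
  x == y = (x ≤ᵇ y) ∧ (y ≤ᵇ x)

  _<_ : Carrier → Carrier → Set
  x < y = x ≤ y × ¬ (x ≡ y)

  _⋖_ : Carrier → Carrier → Set
  x ⋖ y = x < y × (∀ z → x < z → z < y → ⊥)

module RP = RawFinPoset

record IsRankedBoundedFinPoset (P : RawFinPoset) : Set where
  open RawFinPoset P
  field
    elems-complete : ∀ x → x ∈ elems
    elems-unique   : Unique elems
    ≤-refl    : ∀ x → x ≤ x
    ≤-antisym : ∀ {x y} → x ≤ y → y ≤ x → x ≡ y
    ≤-trans   : ∀ {x y z} → x ≤ y → y ≤ z → x ≤ z
    bot-min   : ∀ x → bot ≤ x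
    top-max   : ∀ x → x ≤ top
    rk-bot    : rk bot ≡ 0
    rk-cover  : ∀ {x y} → x ⋖ y → rk y ≡ suc (rk x)

_×ᴾ_ : RawFinPoset → RawFinPoset → RawFinPoset
P ×ᴾ Q = record
  { Carrier = RP.Carrier P × RP.Carrier Q
  ; elems   = cartesianProduct (RP.elems P) (RP.elems Q)
  ; _≤_     = λ u v → RP._≤_ P (proj₁ u) (proj₁ v) × RP._≤_ Q (proj₂ u) (proj₂ v)
  ; _≤?_    = λ u v → dec× (RP._≤?_ P (proj₁ u) (proj₁ v)) (RP._≤?_ Q (proj₂ u) (proj₂ v))
  ; bot     = RP.bot P , RP.bot Q
  ; top     = RP.top P , RP.top Q
  ; rk      = λ u → RP.rk P (proj₁ u) ℕ.+ RP.rk Q (proj₂ u)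
  }
  where open import Relation.Nullary.Decidable using () renaming (_×-dec_ to dec×)

Σℤ : ∀ {A : Set} → List A → (A → ℤ) → ℤ
Σℤ xs f = foldr (λ a s → f a ℤ.+ s) (+ 0) xs

-- The function J on triples, defined by the recursion
--   J(x,y,z) = δ₃(x,y,z) - Σ_{x≤a≤y≤b≤z, (a,b)≠(x,z)} J(a,y,b)   (x≤y≤z)
-- i.e. by the defining relation Σ_{x≤a≤y≤b≤z} J(a,y,b) = δ₃(x,y,z).
-- Structural recursion on fuel; each step strictly shrinks the pair of
-- intervals [a,y]×[y,b], so fuel 2·|S|+1 suffices.

module _ (S : RawFinPoset) where
  open RawFinPoset S

  δ₃ : Carrier → Carrier → Carrier → ℤ
  δ₃ x y z = if (x == y) ∧ (y == z) then + 1 else + 0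

  Jfuel : ℕ → Carrier → Carrier → Carrier → ℤ
  Jfuel zero    x y z = + 0
  Jfuel (suc k) x y z =
    if (x ≤ᵇ y) ∧ (y ≤ᵇ z)
    then δ₃ x y z -
         Σℤ (filter (λ a → (x ≤? a) ×-dec (a ≤? y)) elems) (λ a →
         Σℤ (filter (λ b → (y ≤? b) ×-dec (b ≤? z)) elems) (λ b →
           if (a == x) ∧ (b == z) then + 0 else Jfuel k a y b))
    else + 0
    where open import Relation.Nullary.Decidable using (_×-dec_)

  J : Carrier → Carrier → Carrier → ℤ
  J = Jfuel (suc (length elems ℕ.+ length elems))

  rankS : ℕ
  rankS = rk top

  -- Coefficient of t^k in
  --   𝒥(S,t) = (-1)^{rk S} Σ_{x∈S} J(0̂,x,1̂) t^{rk S - rk x}.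
  Jcoeff : ℕ → ℤ
  Jcoeff k = ((- + 1) ℤ.^ rankS) ℤ.*
             Σℤ (filter (λ x → (rk x ℕ.+ k) ℕ.≟ rankS) elems) (λ x → J bot x top)

-- Polynomials as coefficient functions ℕ → ℤ; product = convolution.

_*ᵖ_ : (ℕ → ℤ) → (ℕ → ℤ) → (ℕ → ℤ)
(f *ᵖ g) k = Σℤ (upTo (suc k)) (λ i → f i ℤ.* g (k ℕ.∸ i))

-- The coefficients of 𝒥(S,t) are signed sums of the numbers J(0̂,x,1̂) over the
-- rank levels of S, so the theorem reduces to multiplicativity of J:
--   J_{P×Q}((x,x'),(y,y'),(z,z')) = J_P(x,y,z) · J_Q(x',y',z').
-- The right-hand side vanishes off chains and satisfies the defining relation
-- Σ_{x≤a≤y≤b≤z} J(a,y,b) = δ₃(x,y,z) of J_{P×Q}, because intervals of P×Q are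
-- products of intervals and δ₃ factors; and that relation determines J, by
-- induction on |[x,y]| + |[y,z]|. Multiplicativity turns the coefficient of t^k
-- in 𝒥(P×Q,t) into a double sum over the pairs (p,q) with
-- rk p + rk q + k = rk P + rk Q, which is the convolution of the coefficient
-- sequences of 𝒥(P,t) and 𝒥(Q,t) because rk p ≤ rk P and rk q ≤ rk Q.
module Submission where

open import Defs
open import Data.Nat using (ℕ)
open import Relation.Binary.PropositionalEquality using (_≡_)

open import Algebra.Bundles using (CommutativeMonoid)
open import Data.Bool using (Bool; true; false; _∧_; if_then_else_)
open import Data.Bool.Properties using (∧-commutativeMonoid)
open import Data.Integer using (ℤ; +_; -_; _-_; _+_; _*_; _^_)
import Data.Integer.Properties as ℤP
open import Data.Integer.Tactic.RingSolver using (solve-∀)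
open import Data.List using (List; []; _∷_; map; filter; length; cartesianProduct; upTo; _++_)
open import Data.List.Properties using (length-filter)
open import Data.List.Membership.Propositional using (_∈_; lose)
open import Data.List.Membership.Propositional.Properties
  using (∈-cartesianProduct⁺; ∈-filter⁺; ∈-filter⁻; ∈-upTo⁺; ∈-upTo⁻)
open import Data.List.Relation.Unary.All using (lookup)
open import Data.List.Relation.Unary.AllPairs using (_∷_)
open import Data.List.Relation.Unary.Any using (here; there; any?; satisfied)
open import Data.List.Relation.Unary.Unique.Propositional using (Unique)
import Data.List.Relation.Unary.Unique.Propositional.Properties as Unique
open import Data.Nat as ℕ using (suc; z≤n; s≤s; _∸_)
import Data.Nat.Properties as ℕP
open import Data.Product using (_×_; _,_; proj₂; uncurry)
open import Function.Bundles using (_⇔_; mk⇔)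
open import Relation.Binary.Definitions using (DecidableEquality)
open import Relation.Binary.PropositionalEquality
  using (_≗_; refl; sym; trans; cong; cong₂; subst; module ≡-Reasoning)
open import Relation.Nullary using (Dec; does; ¬_; yes; no; ¬?; contradiction)
open import Relation.Nullary.Decidable using (_×-dec_; map′; dec-true; dec-false; does-⇔)
open import Relation.Unary using (Pred; Decidable; _⊆_)

import Algebra.Properties.CommutativeSemigroup as CommutativeSemigroupProperties

module ∧  = CommutativeSemigroupProperties (CommutativeMonoid.commutativeSemigroup ∧-commutativeMonoid)
module ℕ+ = CommutativeSemigroupProperties ℕP.+-commutativeSemigroup
module ℤ+ = CommutativeSemigroupProperties ℤP.+-commutativeSemigroup
module ℤ* = CommutativeSemigroupProperties ℤP.*-commutativeSemigroup

𝟙 : Bool → ℤ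
𝟙 b = if b then + 1 else + 0

𝟙-∧ : ∀ a b → 𝟙 (a ∧ b) ≡ 𝟙 a * 𝟙 b
𝟙-∧ true  b = sym (ℤP.*-identityˡ (𝟙 b))
𝟙-∧ false b = refl

𝟙-interchange : ∀ a b c d → 𝟙 ((a ∧ b) ∧ (c ∧ d)) ≡ 𝟙 (a ∧ c) * 𝟙 (b ∧ d)
𝟙-interchange a b c d = trans (cong 𝟙 (∧.interchange a b c d)) (𝟙-∧ (a ∧ c) (b ∧ d))

module _ {A : Set} where

  Σ-cong-∈ : ∀ (xs : List A) {f g : A → ℤ} → (∀ {a} → a ∈ xs → f a ≡ g a) → Σℤ xs f ≡ Σℤ xs g
  Σ-cong-∈ []       f≡g = refl
  Σ-cong-∈ (x ∷ xs) f≡g = cong₂ _+_ (f≡g (here refl)) (Σ-cong-∈ xs (λ a∈ → f≡g (there a∈)))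

  Σ-cong : ∀ (xs : List A) {f g : A → ℤ} → f ≗ g → Σℤ xs f ≡ Σℤ xs g
  Σ-cong xs f≗g = Σ-cong-∈ xs (λ {a} _ → f≗g a)

  Σ-zero : ∀ (xs : List A) → Σℤ xs (λ _ → + 0) ≡ + 0
  Σ-zero []       = refl
  Σ-zero (x ∷ xs) = trans (ℤP.+-identityˡ _) (Σ-zero xs)

  Σ-++ : ∀ (xs ys : List A) (f : A → ℤ) → Σℤ (xs ++ ys) f ≡ Σℤ xs f + Σℤ ys f
  Σ-++ []       ys f = sym (ℤP.+-identityˡ (Σℤ ys f))
  Σ-++ (x ∷ xs) ys f = trans (cong (_+_ (f x)) (Σ-++ xs ys f)) (sym (ℤP.+-assoc (f x) _ _))

  Σ-+ : ∀ (xs : List A) (f g : A → ℤ) → Σℤ xs (λ a → f a + g a) ≡ Σℤ xs f + Σℤ xs g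
  Σ-+ []       f g = refl
  Σ-+ (x ∷ xs) f g = trans (cong (_+_ (f x + g x)) (Σ-+ xs f g)) (ℤ+.interchange (f x) (g x) _ _)

  Σ-*ˡ : ∀ (xs : List A) c (f : A → ℤ) → c * Σℤ xs f ≡ Σℤ xs (λ a → c * f a)
  Σ-*ˡ []       c f = ℤP.*-zeroʳ c
  Σ-*ˡ (x ∷ xs) c f = trans (ℤP.*-distribˡ-+ c (f x) (Σℤ xs f)) (cong (_+_ (c * f x)) (Σ-*ˡ xs c f))

  Σ-*ʳ : ∀ (xs : List A) c (f : A → ℤ) → Σℤ xs f * c ≡ Σℤ xs (λ a → f a * c)
  Σ-*ʳ xs c f = trans (ℤP.*-comm (Σℤ xs f) c)
                      (trans (Σ-*ˡ xs c f) (Σ-cong xs (λ a → ℤP.*-comm c (f a))))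

  Σ-filter : ∀ {p} {P : Pred A p} (P? : Decidable P) xs (f : A → ℤ) →
    Σℤ (filter P? xs) f ≡ Σℤ xs (λ a → 𝟙 (does (P? a)) * f a)
  Σ-filter P? []       f = refl
  Σ-filter P? (x ∷ xs) f with does (P? x)
  ... | true  = cong₂ _+_ (sym (ℤP.*-identityˡ (f x))) (Σ-filter P? xs f)
  ... | false = trans (Σ-filter P? xs f) (sym (ℤP.+-identityˡ _))

  Σ-𝟙-none : ∀ {p} {P : Pred A p} (P? : Decidable P) xs (f : A → ℤ) → (∀ {a} → a ∈ xs → ¬ P a) →
    Σℤ xs (λ a → 𝟙 (does (P? a)) * f a) ≡ + 0
  Σ-𝟙-none P? xs f ¬P = trans (Σ-cong-∈ xs (λ a∈ → cong (λ b → 𝟙 b * f _) (dec-false (P? _) (¬P a∈))))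
                              (Σ-zero xs)

  Σ-𝟙-≡ : ∀ {x} (xs : List A) (_≟x : ∀ a → Dec (a ≡ x)) (f : A → ℤ) → Unique xs → x ∈ xs →
    Σℤ xs (λ a → 𝟙 (does (a ≟x)) * f a) ≡ f x
  Σ-𝟙-≡ (y ∷ ys) _≟x f (y∉ys ∷ _) (here refl) = trans
    (cong₂ _+_ (trans (cong (λ b → 𝟙 b * f y) (dec-true (y ≟x) refl)) (ℤP.*-identityˡ (f y)))
               (Σ-𝟙-none _≟x ys f (λ a∈ a≡y → lookup y∉ys a∈ (sym a≡y))))
    (ℤP.+-identityʳ (f y))
  Σ-𝟙-≡ (y ∷ ys) _≟x f (y∉ys ∷ ys-unique) (there x∈) =
    trans (cong (λ b → 𝟙 b * f y + Σℤ ys (λ a → 𝟙 (does (a ≟x)) * f a)) (dec-false (y ≟x) (lookup y∉ys x∈)))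
          (trans (ℤP.+-identityˡ _) (Σ-𝟙-≡ ys _≟x f ys-unique x∈))

Σ-map : ∀ {A B : Set} (g : A → B) (xs : List A) (f : B → ℤ) → Σℤ (map g xs) f ≡ Σℤ xs (λ a → f (g a))
Σ-map g []       f = refl
Σ-map g (x ∷ xs) f = cong (_+_ (f (g x))) (Σ-map g xs f)

Σ-cartesianProduct : ∀ {A B : Set} (xs : List A) (ys : List B) (f : A × B → ℤ) →
  Σℤ (cartesianProduct xs ys) f ≡ Σℤ xs (λ a → Σℤ ys (λ b → f (a , b)))
Σ-cartesianProduct []       ys f = refl
Σ-cartesianProduct (x ∷ xs) ys f =
  trans (Σ-++ (map (x ,_) ys) _ f) (cong₂ _+_ (Σ-map (x ,_) ys f) (Σ-cartesianProduct xs ys f))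

Σ-swap : ∀ {A B : Set} (xs : List A) (ys : List B) (f : A → B → ℤ) →
  Σℤ xs (λ a → Σℤ ys (λ b → f a b)) ≡ Σℤ ys (λ b → Σℤ xs (λ a → f a b))
Σ-swap []       ys f = sym (Σ-zero ys)
Σ-swap (x ∷ xs) ys f = trans (cong (_+_ (Σℤ ys (f x))) (Σ-swap xs ys f)) (sym (Σ-+ ys (f x) _))

Σ-*-Σ : ∀ {A B : Set} (xs : List A) (ys : List B) (f : A → ℤ) (g : B → ℤ) →
  Σℤ xs f * Σℤ ys g ≡ Σℤ xs (λ a → Σℤ ys (λ b → f a * g b))
Σ-*-Σ xs ys f g = trans (Σ-*ʳ xs (Σℤ ys g) f) (Σ-cong xs (λ a → Σ-*ˡ ys (f a) g))

module _ {A : Set} {p q} {P : Pred A p} {Q : Pred A q} (P? : Decidable P) (Q? : Decidable Q) (P⊆Q : P ⊆ Q) where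

  length-filter-mono : ∀ xs → length (filter P? xs) ℕ.≤ length (filter Q? xs)
  length-filter-mono []       = z≤n
  length-filter-mono (x ∷ xs) with P? x | Q? x
  ... | yes p | yes _ = s≤s (length-filter-mono xs)
  ... | yes p | no ¬q = contradiction (P⊆Q p) ¬q
  ... | no _  | yes _ = ℕP.m≤n⇒m≤1+n (length-filter-mono xs)
  ... | no _  | no _  = length-filter-mono xs

  length-filter-strict : ∀ {xs u} → u ∈ xs → Q u → ¬ P u → length (filter P? xs) ℕ.< length (filter Q? xs)
  length-filter-strict {x ∷ xs} (here refl) qu ¬pu with P? x | Q? x
  ... | yes pu | _     = contradiction pu ¬pu
  ... | no _   | yes _ = s≤s (length-filter-mono xs)
  ... | no _   | no ¬q = contradiction qu ¬q
  length-filter-strict {x ∷ xs} (there u∈) qu ¬pu with P? x | Q? x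
  ... | yes p | yes _ = s≤s (length-filter-strict u∈ qu ¬pu)
  ... | yes p | no ¬q = contradiction (P⊆Q p) ¬q
  ... | no _  | yes _ = ℕP.m≤n⇒m≤1+n (length-filter-strict u∈ qu ¬pu)
  ... | no _  | no _  = length-filter-strict u∈ qu ¬pu

+-≡⇔≡∸ : ∀ {a c i} → a ℕ.≤ c → (a ℕ.+ i ≡ c) ⇔ (i ≡ c ∸ a)
+-≡⇔≡∸ {a} {c} {i} a≤c = mk⇔ (λ a+i≡c → trans (sym (ℕP.m+n∸m≡n a i)) (cong (_∸ a) a+i≡c))
                             (λ i≡c∸a → trans (cong (a ℕ.+_) i≡c∸a) (ℕP.m+[n∸m]≡n a≤c))

Σ-𝟙-antidiagonal : ∀ k m n →
  Σℤ (upTo (suc k)) (λ i → 𝟙 (does (i ℕ.≟ m)) * 𝟙 (does (k ∸ i ℕ.≟ n))) ≡ 𝟙 (does (k ℕ.≟ m ℕ.+ n))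
Σ-𝟙-antidiagonal k m n with m ℕ.≤? k
... | yes m≤k =
  trans (Σ-𝟙-≡ (upTo (suc k)) (ℕ._≟ m) (λ i → 𝟙 (does (k ∸ i ℕ.≟ n))) (Unique.upTo⁺ (suc k)) (∈-upTo⁺ (s≤s m≤k)))
        (cong 𝟙 (does-⇔ k∸m≡n⇔k≡m+n (k ∸ m ℕ.≟ n) (k ℕ.≟ m ℕ.+ n)))
  where
  k∸m≡n⇔k≡m+n : (k ∸ m ≡ n) ⇔ (k ≡ m ℕ.+ n)
  k∸m≡n⇔k≡m+n = mk⇔ (λ k∸m≡n → trans (sym (ℕP.m+[n∸m]≡n m≤k)) (cong (m ℕ.+_) k∸m≡n))
                    (λ k≡m+n → trans (cong (_∸ m) k≡m+n) (ℕP.m+n∸m≡n m n))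
... | no m≰k =
  trans (Σ-𝟙-none (ℕ._≟ m) (upTo (suc k)) _ (λ i∈ i≡m → m≰k (subst (ℕ._≤ k) i≡m (ℕP.≤-pred (∈-upTo⁻ i∈)))))
        (cong 𝟙 (sym (dec-false (k ℕ.≟ m ℕ.+ n) (λ e → m≰k (subst (m ℕ.≤_) (sym e) (ℕP.m≤m+n m n))))))

Σ-𝟙-convolution : ∀ {a b c d} k → a ℕ.≤ c → b ℕ.≤ d →
  Σℤ (upTo (suc k)) (λ i → 𝟙 (does (a ℕ.+ i ℕ.≟ c)) * 𝟙 (does (b ℕ.+ (k ∸ i) ℕ.≟ d)))
    ≡ 𝟙 (does ((a ℕ.+ b) ℕ.+ k ℕ.≟ c ℕ.+ d))
Σ-𝟙-convolution {a} {b} {c} {d} k a≤c b≤d = begin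
    Σℤ (upTo (suc k)) (λ i → 𝟙 (does (a ℕ.+ i ℕ.≟ c)) * 𝟙 (does (b ℕ.+ (k ∸ i) ℕ.≟ d)))
  ≡⟨ Σ-cong (upTo (suc k)) (λ i → cong₂ (λ s t → 𝟙 s * 𝟙 t)
       (does-⇔ (+-≡⇔≡∸ a≤c) (a ℕ.+ i ℕ.≟ c) (i ℕ.≟ c ∸ a))
       (does-⇔ (+-≡⇔≡∸ b≤d) (b ℕ.+ (k ∸ i) ℕ.≟ d) (k ∸ i ℕ.≟ d ∸ b))) ⟩
    Σℤ (upTo (suc k)) (λ i → 𝟙 (does (i ℕ.≟ c ∸ a)) * 𝟙 (does (k ∸ i ℕ.≟ d ∸ b)))
  ≡⟨ Σ-𝟙-antidiagonal k (c ∸ a) (d ∸ b) ⟩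
    𝟙 (does (k ℕ.≟ (c ∸ a) ℕ.+ (d ∸ b)))
  ≡⟨ cong 𝟙 (does-⇔ (mk⇔ (λ e → trans (cong ((a ℕ.+ b) ℕ.+_) e) split)
                         (λ e → ℕP.+-cancelˡ-≡ (a ℕ.+ b) _ _ (trans e (sym split))))
                    (k ℕ.≟ (c ∸ a) ℕ.+ (d ∸ b)) ((a ℕ.+ b) ℕ.+ k ℕ.≟ c ℕ.+ d)) ⟩
    𝟙 (does ((a ℕ.+ b) ℕ.+ k ℕ.≟ c ℕ.+ d))
  ∎
  where
  open ≡-Reasoning
  split : (a ℕ.+ b) ℕ.+ ((c ∸ a) ℕ.+ (d ∸ b)) ≡ c ℕ.+ d
  split = trans (ℕ+.interchange a b (c ∸ a) (d ∸ b)) (cong₂ ℕ._+_ (ℕP.m+[n∸m]≡n a≤c) (ℕP.m+[n∸m]≡n b≤d))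

record IsFinPoset (S : RawFinPoset) : Set where
  open RawFinPoset S
  field
    elems-complete : ∀ x → x ∈ elems
    elems-unique   : Unique elems
    ≤-refl    : ∀ x → x ≤ x
    ≤-antisym : ∀ {x y} → x ≤ y → y ≤ x → x ≡ y
    ≤-trans   : ∀ {x y z} → x ≤ y → y ≤ z → x ≤ z

isFinPoset : ∀ {S} → IsRankedBoundedFinPoset S → IsFinPoset S
isFinPoset isS = record { IsRankedBoundedFinPoset isS }

module FinPoset (S : RawFinPoset) (isS : IsFinPoset S) where
  open RawFinPoset S
  open IsFinPoset isS

  -- Agrees definitionally with the Boolean equality _==_ used by J and δ₃.
  _≟_ : DecidableEquality Carrier
  x ≟ y = map′ (uncurry ≤-antisym) (λ { refl → ≤-refl x , ≤-refl x }) ((x ≤? y) ×-dec (y ≤? x))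

  _<?_ : ∀ x y → Dec (x < y)
  x <? y = (x ≤? y) ×-dec ¬? (x ≟ y)

  interval : Carrier → Carrier → List Carrier
  interval x y = filter (λ a → (x ≤? a) ×-dec (a ≤? y)) elems

  ∈-interval⁻ : ∀ {x y a} → a ∈ interval x y → x ≤ a × a ≤ y
  ∈-interval⁻ {x} {y} a∈ = proj₂ (∈-filter⁻ (λ a → (x ≤? a) ×-dec (a ≤? y)) {xs = elems} a∈)

  ∈-interval⁺ : ∀ {x y a} → x ≤ a → a ≤ y → a ∈ interval x y
  ∈-interval⁺ {x} {y} {a} x≤a a≤y = ∈-filter⁺ (λ a → (x ≤? a) ×-dec (a ≤? y)) (elems-complete a) (x≤a , a≤y)

  interval-unique : ∀ x y → Unique (interval x y)
  interval-unique x y = Unique.filter⁺ (λ a → (x ≤? a) ×-dec (a ≤? y)) elems-unique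

  length-interval-≤ : ∀ {x x' y y'} → x ≤ x' → y' ≤ y →
    length (interval x' y') ℕ.≤ length (interval x y)
  length-interval-≤ x≤x' y'≤y =
    length-filter-mono _ _ (λ (x'≤a , a≤y') → ≤-trans x≤x' x'≤a , ≤-trans a≤y' y'≤y) elems

  length-interval-< : ∀ {x x' y y' u} → x ≤ x' → y' ≤ y → u ∈ interval x y → ¬ (x' ≤ u × u ≤ y') →
    length (interval x' y') ℕ.< length (interval x y)
  length-interval-< {u = u} x≤x' y'≤y u∈ u∉ =
    length-filter-strict _ _ (λ (x'≤a , a≤y') → ≤-trans x≤x' x'≤a , ≤-trans a≤y' y'≤y)
      (elems-complete u) (∈-interval⁻ u∈) u∉

  -- Induction on |[x,y]|: split at an element strictly between x and y if there is
  -- one; otherwise x ⋖ y.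
  module _ (rk-cover : ∀ {x y} → x ⋖ y → rk y ≡ suc (rk x)) where

    rk-mono-bounded : ∀ m {x y} → length (interval x y) ℕ.< m → x ≤ y → rk x ℕ.≤ rk y
    rk-mono-bounded (suc m) {x} {y} (s≤s len≤m) x≤y with x ≟ y
    ... | yes refl = ℕP.≤-refl
    ... | no x≢y with any? (λ z → (x <? z) ×-dec (z <? y)) elems
    ...   | yes between =
      let (z , (x≤z , x≢z) , (z≤y , z≢y)) = satisfied between in
      ℕP.≤-trans
        (rk-mono-bounded m (ℕP.<-≤-trans (length-interval-< (≤-refl x) z≤y (∈-interval⁺ x≤y (≤-refl y))
                                            (λ (_ , y≤z) → z≢y (≤-antisym z≤y y≤z))) len≤m) x≤z)
        (rk-mono-bounded m (ℕP.<-≤-trans (length-interval-< x≤z (≤-refl y) (∈-interval⁺ (≤-refl x) x≤y)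
                                            (λ (z≤x , _) → x≢z (≤-antisym x≤z z≤x))) len≤m) z≤y)
    ...   | no nothing-between =
      ℕP.≤-trans (ℕP.n≤1+n (rk x)) (ℕP.≤-reflexive (sym (rk-cover x⋖y)))
      where
      x⋖y : x ⋖ y
      x⋖y = (x≤y , x≢y) , λ z x<z z<y → nothing-between (lose (elems-complete z) (x<z , z<y))

    rk-mono : ∀ {x y} → x ≤ y → rk x ℕ.≤ rk y
    rk-mono = rk-mono-bounded _ ℕP.≤-refl

  Fun₃ : Set
  Fun₃ = Carrier → Carrier → Carrier → ℤ

  chainSum : Fun₃ → Fun₃
  chainSum F x y z = Σℤ (interval x y) (λ a → Σℤ (interval y z) (λ b → F a y b))

  properChainSum : Fun₃ → Fun₃
  properChainSum F x y z = Σℤ (interval x y) (λ a → Σℤ (interval y z) (λ b →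
    if does (a ≟ x) ∧ does (b ≟ z) then + 0 else F a y b))

  -- Jfuel S (suc k) is Jstep (Jfuel S k) by definition.
  Jstep : Fun₃ → Fun₃
  Jstep F x y z = if (x ≤ᵇ y) ∧ (y ≤ᵇ z) then δ₃ S x y z - properChainSum F x y z else + 0

  Inner : (x y z a b : Carrier) → Set
  Inner x y z a b = a ∈ interval x y × b ∈ interval y z × ¬ (a ≡ x × b ≡ z)

  Jstep-cong : ∀ F H {x y z} → (∀ {a b} → Inner x y z a b → F a y b ≡ H a y b) →
    Jstep F x y z ≡ Jstep H x y z
  Jstep-cong F H {x} {y} {z} F≡H =
    cong (λ s → if (x ≤ᵇ y) ∧ (y ≤ᵇ z) then δ₃ S x y z - s else + 0)
         (Σ-cong-∈ (interval x y) λ a∈ → Σ-cong-∈ (interval y z) λ b∈ → term a∈ b∈)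
    where
    term : ∀ {a b} → a ∈ interval x y → b ∈ interval y z →
      (if does (a ≟ x) ∧ does (b ≟ z) then + 0 else F a y b) ≡
      (if does (a ≟ x) ∧ does (b ≟ z) then + 0 else H a y b)
    term {a} {b} a∈ b∈ = byCases (a ≟ x) (b ≟ z)
      where
      byCases : (a≟x : Dec (a ≡ x)) (b≟z : Dec (b ≡ z)) →
        (if does a≟x ∧ does b≟z then + 0 else F a y b) ≡ (if does a≟x ∧ does b≟z then + 0 else H a y b)
      byCases (yes _)   (yes _)   = refl
      byCases (yes _)   (no b≢z)  = F≡H (a∈ , b∈ , λ (_ , b≡z) → b≢z b≡z)
      byCases (no a≢x)  _         = F≡H (a∈ , b∈ , λ (a≡x , _) → a≢x a≡x)

  Jstep-chain : ∀ F {x y z} → x ≤ y → y ≤ z → Jstep F x y z ≡ δ₃ S x y z - properChainSum F x y z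
  Jstep-chain F {x} {y} {z} x≤y y≤z =
    cong (λ c → if c then δ₃ S x y z - properChainSum F x y z else + 0)
         (cong₂ _∧_ (dec-true (x ≤? y) x≤y) (dec-true (y ≤? z) y≤z))

  Jstep-offChain : ∀ F {x y z} → ¬ (x ≤ y × y ≤ z) → Jstep F x y z ≡ + 0
  Jstep-offChain F {x} {y} {z} ¬chain =
    cong (λ c → if c then δ₃ S x y z - properChainSum F x y z else + 0)
         (dec-false ((x ≤? y) ×-dec (y ≤? z)) ¬chain)

  size : Carrier → Carrier → Carrier → ℕ
  size x y z = length (interval x y) ℕ.+ length (interval y z)

  size-bound : ∀ x y z → size x y z ℕ.≤ length elems ℕ.+ length elems
  size-bound x y z = ℕP.+-mono-≤ (length-filter _ elems) (length-filter _ elems)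

  size-< : ∀ {x y z a b} → Inner x y z a b → size a y b ℕ.< size x y z
  size-< {x} {y} {z} {a} {b} (a∈ , b∈ , ≢xz) with ∈-interval⁻ a∈ | ∈-interval⁻ b∈ | a ≟ x
  ... | x≤a , a≤y | y≤b , b≤z | yes refl =
    ℕP.+-monoʳ-< (length (interval x y))
      (length-interval-< (≤-refl y) b≤z (∈-interval⁺ (≤-trans y≤b b≤z) (≤-refl z))
         (λ (_ , z≤b) → ≢xz (refl , ≤-antisym b≤z z≤b)))
  ... | x≤a , a≤y | y≤b , b≤z | no a≢x =
    ℕP.+-mono-<-≤
      (length-interval-< x≤a (≤-refl y) (∈-interval⁺ (≤-refl x) (≤-trans x≤a a≤y))
         (λ (a≤x , _) → a≢x (≤-antisym a≤x x≤a)))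
      (length-interval-≤ (≤-refl y) b≤z)

  Jfuel-stable : ∀ k k' {x y z} → size x y z ℕ.< k → size x y z ℕ.< k' → Jfuel S k x y z ≡ Jfuel S k' x y z
  Jfuel-stable (suc k) (suc k') (s≤s size≤k) (s≤s size≤k') = Jstep-cong (Jfuel S k) (Jfuel S k') λ inner →
    Jfuel-stable k k' (ℕP.<-≤-trans (size-< inner) size≤k) (ℕP.<-≤-trans (size-< inner) size≤k')

  J-fixed : ∀ x y z → J S x y z ≡ Jstep (J S) x y z
  J-fixed x y z = Jstep-cong (Jfuel S (length elems ℕ.+ length elems)) (J S) λ inner →
    let size<n+n = ℕP.<-≤-trans (size-< inner) (size-bound x y z) in
    Jfuel-stable _ _ size<n+n (ℕP.m<n⇒m<1+n size<n+n)

  Jfuel-fixedPoint : ∀ {F} → (∀ x y z → F x y z ≡ Jstep F x y z) →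
    ∀ k {x y z} → size x y z ℕ.< k → Jfuel S k x y z ≡ F x y z
  Jfuel-fixedPoint {F} F-fixed (suc k) {x} {y} {z} (s≤s size≤k) =
    trans (Jstep-cong (Jfuel S k) F λ inner → Jfuel-fixedPoint F-fixed k (ℕP.<-≤-trans (size-< inner) size≤k))
          (sym (F-fixed x y z))

  chainSum-split : ∀ F {x y z} → x ≤ y → y ≤ z → chainSum F x y z ≡ properChainSum F x y z + F x y z
  chainSum-split F {x} {y} {z} x≤y y≤z = begin
      chainSum F x y z
    ≡⟨ Σ-cong (interval x y) (λ a → Σ-cong (interval y z) (λ b → F≡proper+diagonal a b)) ⟩
      Σℤ (interval x y) (λ a → Σℤ (interval y z) (λ b → proper a b + diagonal a b))
    ≡⟨ Σ-cong (interval x y) (λ a → Σ-+ (interval y z) (proper a) (diagonal a)) ⟩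
      Σℤ (interval x y) (λ a → Σℤ (interval y z) (proper a) + Σℤ (interval y z) (diagonal a))
    ≡⟨ Σ-+ (interval x y) (λ a → Σℤ (interval y z) (proper a)) (λ a → Σℤ (interval y z) (diagonal a)) ⟩
      properChainSum F x y z + Σℤ (interval x y) (λ a → Σℤ (interval y z) (diagonal a))
    ≡⟨ cong (_+_ (properChainSum F x y z)) diagonalSum ⟩
      properChainSum F x y z + F x y z
    ∎
    where
    open ≡-Reasoning
    proper diagonal : Carrier → Carrier → ℤ
    proper   a b = if does (a ≟ x) ∧ does (b ≟ z) then + 0 else F a y b
    diagonal a b = 𝟙 (does (a ≟ x) ∧ does (b ≟ z)) * F a y b

    F≡proper+diagonal : ∀ a b → F a y b ≡ proper a b + diagonal a b
    F≡proper+diagonal a b with does (a ≟ x) ∧ does (b ≟ z)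
    ... | true  = sym (trans (ℤP.+-identityˡ _) (ℤP.*-identityˡ (F a y b)))
    ... | false = sym (ℤP.+-identityʳ (F a y b))

    diagonalSum : Σℤ (interval x y) (λ a → Σℤ (interval y z) (diagonal a)) ≡ F x y z
    diagonalSum = begin
        Σℤ (interval x y) (λ a → Σℤ (interval y z) (diagonal a))
      ≡⟨ Σ-cong (interval x y) (λ a → trans
           (Σ-cong (interval y z) (λ b → trans (cong (_* F a y b) (𝟙-∧ (does (a ≟ x)) (does (b ≟ z))))
                                               (ℤP.*-assoc (𝟙 (does (a ≟ x))) _ _)))
           (sym (Σ-*ˡ (interval y z) (𝟙 (does (a ≟ x))) _))) ⟩
        Σℤ (interval x y) (λ a → 𝟙 (does (a ≟ x)) * Σℤ (interval y z) (λ b → 𝟙 (does (b ≟ z)) * F a y b))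
      ≡⟨ Σ-𝟙-≡ (interval x y) (_≟ x) _ (interval-unique x y) (∈-interval⁺ (≤-refl x) x≤y) ⟩
        Σℤ (interval y z) (λ b → 𝟙 (does (b ≟ z)) * F x y b)
      ≡⟨ Σ-𝟙-≡ (interval y z) (_≟ z) _ (interval-unique y z) (∈-interval⁺ y≤z (≤-refl z)) ⟩
        F x y z
      ∎

  SatisfiesChainRelation : Fun₃ → Set
  SatisfiesChainRelation F = ∀ {x y z} → x ≤ y → y ≤ z → chainSum F x y z ≡ δ₃ S x y z

  VanishesOffChains : Fun₃ → Set
  VanishesOffChains F = ∀ {x y z} → ¬ (x ≤ y × y ≤ z) → F x y z ≡ + 0

  J-vanishesOffChains : VanishesOffChains (J S)
  J-vanishesOffChains {x} {y} {z} ¬chain = trans (J-fixed x y z) (Jstep-offChain (J S) ¬chain)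

  J-satisfiesChainRelation : SatisfiesChainRelation (J S)
  J-satisfiesChainRelation {x} {y} {z} x≤y y≤z = begin
      chainSum (J S) x y z
    ≡⟨ chainSum-split (J S) x≤y y≤z ⟩
      properChainSum (J S) x y z + J S x y z
    ≡⟨ cong (_+_ (properChainSum (J S) x y z)) (trans (J-fixed x y z) (Jstep-chain (J S) x≤y y≤z)) ⟩
      properChainSum (J S) x y z + (δ₃ S x y z - properChainSum (J S) x y z)
    ≡⟨ m+[n-m]≡n (properChainSum (J S) x y z) (δ₃ S x y z) ⟩
      δ₃ S x y z
    ∎
    where
    open ≡-Reasoning
    m+[n-m]≡n : ∀ m n → m + (n - m) ≡ n
    m+[n-m]≡n = solve-∀

  J-unique : ∀ {F} → SatisfiesChainRelation F → VanishesOffChains F → ∀ x y z → J S x y z ≡ F x y z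
  J-unique {F} F-chain F-vanishes x y z = Jfuel-fixedPoint F-fixed _ (s≤s (size-bound x y z))
    where
    n≡[m+n]-m : ∀ m n → n ≡ (m + n) - m
    n≡[m+n]-m = solve-∀

    F-fixed : ∀ x y z → F x y z ≡ Jstep F x y z
    F-fixed x y z with (x ≤? y) ×-dec (y ≤? z)
    ... | yes (x≤y , y≤z) = begin
        F x y z
      ≡⟨ n≡[m+n]-m (properChainSum F x y z) (F x y z) ⟩
        (properChainSum F x y z + F x y z) - properChainSum F x y z
      ≡⟨ cong (_- properChainSum F x y z) (trans (sym (chainSum-split F x≤y y≤z)) (F-chain x≤y y≤z)) ⟩
        δ₃ S x y z - properChainSum F x y z
      ≡⟨ sym (Jstep-chain F x≤y y≤z) ⟩
        Jstep F x y z
      ∎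
      where open ≡-Reasoning
    ... | no ¬chain = trans (F-vanishes ¬chain) (sym (Jstep-offChain F ¬chain))

levelSum : RawFinPoset → ℕ → ℤ
levelSum S k = Σℤ (RP.elems S) (λ x →
  𝟙 (does (RP.rk S x ℕ.+ k ℕ.≟ rankS S)) * J S (RP.bot S) x (RP.top S))

Jcoeff≡sign*levelSum : ∀ S k → Jcoeff S k ≡ (- + 1) ^ rankS S * levelSum S k
Jcoeff≡sign*levelSum S k = cong ((- + 1) ^ rankS S *_) (Σ-filter _ (RP.elems S) _)

rk≤rankS : ∀ S → IsRankedBoundedFinPoset S → ∀ x → RP.rk S x ℕ.≤ rankS S
rk≤rankS S isS x = FinPoset.rk-mono S (isFinPoset isS) rk-cover (top-max x)
  where open IsRankedBoundedFinPoset isS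

module Product (P Q : RawFinPoset) (isP : IsFinPoset P) (isQ : IsFinPoset Q) where
  module P  = RawFinPoset P
  module Q  = RawFinPoset Q
  module IP = IsFinPoset isP
  module IQ = IsFinPoset isQ
  module FP = FinPoset P isP
  module FQ = FinPoset Q isQ

  isFinPoset-× : IsFinPoset (P ×ᴾ Q)
  isFinPoset-× = record
    { elems-complete = λ (x , x') → ∈-cartesianProduct⁺ (IP.elems-complete x) (IQ.elems-complete x')
    ; elems-unique   = Unique.cartesianProduct⁺ IP.elems-unique IQ.elems-unique
    ; ≤-refl         = λ (x , x') → IP.≤-refl x , IQ.≤-refl x'
    ; ≤-antisym      = λ (p , p') (q , q') → cong₂ _,_ (IP.≤-antisym p q) (IQ.≤-antisym p' q')
    ; ≤-trans        = λ (p , p') (q , q') → IP.≤-trans p q , IQ.≤-trans p' q'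
    }

  module FPQ = FinPoset (P ×ᴾ Q) isFinPoset-×

  Σ-interval-× : ∀ {x x' y y'} f →
    Σℤ (FPQ.interval (x , x') (y , y')) f ≡
    Σℤ (FP.interval x y) (λ a → Σℤ (FQ.interval x' y') (λ a' → f (a , a')))
  Σ-interval-× {x} {x'} {y} {y'} f = begin
      Σℤ (FPQ.interval (x , x') (y , y')) f
    ≡⟨ Σ-filter _ (cartesianProduct P.elems Q.elems) f ⟩
      Σℤ (cartesianProduct P.elems Q.elems) (λ u → 𝟙 (does (inPQ u)) * f u)
    ≡⟨ Σ-cartesianProduct P.elems Q.elems (λ u → 𝟙 (does (inPQ u)) * f u) ⟩
      Σℤ P.elems (λ a → Σℤ Q.elems (λ a' → 𝟙 (does (inPQ (a , a'))) * f (a , a')))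
    ≡⟨ Σ-cong P.elems (λ a → trans (Σ-cong Q.elems (λ a' → factor a a'))
                                    (sym (Σ-*ˡ Q.elems (𝟙 (does (inP a))) (λ a' → 𝟙 (does (inQ a')) * f (a , a'))))) ⟩
      Σℤ P.elems (λ a → 𝟙 (does (inP a)) * Σℤ Q.elems (λ a' → 𝟙 (does (inQ a')) * f (a , a')))
    ≡⟨ sym (trans (Σ-filter inP P.elems (λ a → Σℤ (FQ.interval x' y') (λ a' → f (a , a'))))
                  (Σ-cong P.elems (λ a → cong (𝟙 (does (inP a)) *_) (Σ-filter inQ Q.elems (λ a' → f (a , a')))))) ⟩
      Σℤ (FP.interval x y) (λ a → Σℤ (FQ.interval x' y') (λ a' → f (a , a')))
    ∎
    where
    open ≡-Reasoning
    inP = λ a → (x P.≤? a) ×-dec (a P.≤? y)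
    inQ = λ a' → (x' Q.≤? a') ×-dec (a' Q.≤? y')
    inPQ = λ u → RP._≤?_ (P ×ᴾ Q) (x , x') u ×-dec RP._≤?_ (P ×ᴾ Q) u (y , y')
    factor : ∀ a a' → 𝟙 (does (inPQ (a , a'))) * f (a , a') ≡ 𝟙 (does (inP a)) * (𝟙 (does (inQ a')) * f (a , a'))
    factor a a' = trans (cong (_* f (a , a')) (𝟙-interchange (does (x P.≤? a)) (does (x' Q.≤? a'))
                                                             (does (a P.≤? y)) (does (a' Q.≤? y'))))
                        (ℤP.*-assoc (𝟙 (does (inP a))) _ _)

  δ₃-× : ∀ {x x' y y' z z'} → δ₃ (P ×ᴾ Q) (x , x') (y , y') (z , z') ≡ δ₃ P x y z * δ₃ Q x' y' z'
  δ₃-× {x} {x'} {y} {y'} {z} {z'} = trans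
    (cong 𝟙 (cong₂ _∧_ (∧.interchange (x P.≤ᵇ y) (x' Q.≤ᵇ y') (y P.≤ᵇ x) (y' Q.≤ᵇ x'))
                       (∧.interchange (y P.≤ᵇ z) (y' Q.≤ᵇ z') (z P.≤ᵇ y) (z' Q.≤ᵇ y'))))
    (𝟙-interchange (x P.== y) (x' Q.== y') (y P.== z) (y' Q.== z'))

  J⊗J : FPQ.Fun₃
  J⊗J (x , x') (y , y') (z , z') = J P x y z * J Q x' y' z'

  J⊗J-vanishesOffChains : FPQ.VanishesOffChains J⊗J
  J⊗J-vanishesOffChains {x , x'} {y , y'} {z , z'} ¬chain with (x P.≤? y) ×-dec (y P.≤? z)
  ... | yes (x≤y , y≤z) = trans (cong (J P x y z *_)
                                      (FQ.J-vanishesOffChains λ (x'≤y' , y'≤z') → ¬chain ((x≤y , x'≤y') , (y≤z , y'≤z'))))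
                                (ℤP.*-zeroʳ (J P x y z))
  ... | no ¬chainP = cong (_* J Q x' y' z') (FP.J-vanishesOffChains ¬chainP)

  J⊗J-satisfiesChainRelation : FPQ.SatisfiesChainRelation J⊗J
  J⊗J-satisfiesChainRelation {x , x'} {y , y'} {z , z'} (x≤y , x'≤y') (y≤z , y'≤z') = begin
      FPQ.chainSum J⊗J (x , x') (y , y') (z , z')
    ≡⟨ trans (Σ-interval-× (λ A → Σℤ (FPQ.interval (y , y') (z , z')) (J⊗J A (y , y'))))
             (Σ-cong (FP.interval x y) λ a → Σ-cong (FQ.interval x' y') λ a' →
                Σ-interval-× (J⊗J (a , a') (y , y'))) ⟩
      Σℤ (FP.interval x y) (λ a → Σℤ (FQ.interval x' y') (λ a' →
        Σℤ (FP.interval y z) (λ b → Σℤ (FQ.interval y' z') (λ b' → J P a y b * J Q a' y' b'))))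
    ≡⟨ sym (trans (Σ-*-Σ (FP.interval x y) (FQ.interval x' y')
                         (λ a → Σℤ (FP.interval y z) (J P a y)) (λ a' → Σℤ (FQ.interval y' z') (J Q a' y')))
                  (Σ-cong (FP.interval x y) λ a → Σ-cong (FQ.interval x' y') λ a' →
                     Σ-*-Σ (FP.interval y z) (FQ.interval y' z') (J P a y) (J Q a' y'))) ⟩
      FP.chainSum (J P) x y z * FQ.chainSum (J Q) x' y' z'
    ≡⟨ cong₂ _*_ (FP.J-satisfiesChainRelation x≤y y≤z) (FQ.J-satisfiesChainRelation x'≤y' y'≤z') ⟩
      δ₃ P x y z * δ₃ Q x' y' z'
    ≡⟨ sym δ₃-× ⟩
      δ₃ (P ×ᴾ Q) (x , x') (y , y') (z , z')
    ∎
    where open ≡-Reasoning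

  J-× : ∀ x x' y y' z z' → J (P ×ᴾ Q) (x , x') (y , y') (z , z') ≡ J P x y z * J Q x' y' z'
  J-× x x' y y' z z' =
    FPQ.J-unique J⊗J-satisfiesChainRelation J⊗J-vanishesOffChains (x , x') (y , y') (z , z')

module Coefficients (P Q : RawFinPoset) (isP : IsRankedBoundedFinPoset P) (isQ : IsRankedBoundedFinPoset Q) where
  open Product P Q (isFinPoset isP) (isFinPoset isQ)

  jP : P.Carrier → ℤ
  jP p = J P P.bot p P.top

  jQ : Q.Carrier → ℤ
  jQ q = J Q Q.bot q Q.top

  onLevel : ℕ → P.Carrier → Q.Carrier → ℤ
  onLevel k p q = 𝟙 (does ((P.rk p ℕ.+ Q.rk q) ℕ.+ k ℕ.≟ rankS P ℕ.+ rankS Q))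

  pairSum : ℕ → ℤ
  pairSum k = Σℤ P.elems (λ p → Σℤ Q.elems (λ q → onLevel k p q * (jP p * jQ q)))

  levelSum-× : ∀ k → levelSum (P ×ᴾ Q) k ≡ pairSum k
  levelSum-× k = trans
    (Σ-cartesianProduct P.elems Q.elems (λ u →
       𝟙 (does (RP.rk (P ×ᴾ Q) u ℕ.+ k ℕ.≟ rankS (P ×ᴾ Q))) * J (P ×ᴾ Q) (P.bot , Q.bot) u (P.top , Q.top)))
    (Σ-cong P.elems λ p → Σ-cong Q.elems λ q → cong (onLevel k p q *_) (J-× _ _ _ _ _ _))

  levelSum-convolution : ∀ k → Σℤ (upTo (suc k)) (λ i → levelSum P i * levelSum Q (k ∸ i)) ≡ pairSum k
  levelSum-convolution k = begin
      Σℤ is (λ i → levelSum P i * levelSum Q (k ∸ i))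
    ≡⟨ Σ-cong is (λ i → Σ-*-Σ P.elems Q.elems (λ p → 𝟙P i p * jP p) (λ q → 𝟙Q i q * jQ q)) ⟩
      Σℤ is (λ i → Σℤ P.elems (λ p → Σℤ Q.elems (term i p)))
    ≡⟨ trans (Σ-swap is P.elems (λ i p → Σℤ Q.elems (term i p)))
             (Σ-cong P.elems (λ p → Σ-swap is Q.elems (λ i → term i p))) ⟩
      Σℤ P.elems (λ p → Σℤ Q.elems (λ q → Σℤ is (λ i → term i p q)))
    ≡⟨ Σ-cong P.elems (λ p → Σ-cong Q.elems (λ q → trans
         (Σ-cong is (λ i → ℤ*.interchange (𝟙P i p) (jP p) (𝟙Q i q) (jQ q)))
         (sym (Σ-*ʳ is (jP p * jQ q) (λ i → 𝟙P i p * 𝟙Q i q))))) ⟩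
      Σℤ P.elems (λ p → Σℤ Q.elems (λ q → Σℤ is (λ i → 𝟙P i p * 𝟙Q i q) * (jP p * jQ q)))
    ≡⟨ Σ-cong P.elems (λ p → Σ-cong Q.elems (λ q → cong (_* (jP p * jQ q))
         (Σ-𝟙-convolution k (rk≤rankS P isP p) (rk≤rankS Q isQ q)))) ⟩
      pairSum k
    ∎
    where
    open ≡-Reasoning
    is : List ℕ
    is = upTo (suc k)
    𝟙P : ℕ → P.Carrier → ℤ
    𝟙P i p = 𝟙 (does (P.rk p ℕ.+ i ℕ.≟ rankS P))
    𝟙Q : ℕ → Q.Carrier → ℤ
    𝟙Q i q = 𝟙 (does (Q.rk q ℕ.+ (k ∸ i) ℕ.≟ rankS Q))
    term : ℕ → P.Carrier → Q.Carrier → ℤ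
    term i p q = (𝟙P i p * jP p) * (𝟙Q i q * jQ q)

  *ᵖ-Jcoeff : ∀ k → (Jcoeff P *ᵖ Jcoeff Q) k ≡ (- + 1) ^ rankS (P ×ᴾ Q) * pairSum k
  *ᵖ-Jcoeff k = begin
      Σℤ (upTo (suc k)) (λ i → Jcoeff P i * Jcoeff Q (k ∸ i))
    ≡⟨ Σ-cong (upTo (suc k)) (λ i →
         trans (cong₂ _*_ (Jcoeff≡sign*levelSum P i) (Jcoeff≡sign*levelSum Q (k ∸ i)))
               (ℤ*.interchange σP (levelSum P i) σQ (levelSum Q (k ∸ i)))) ⟩
      Σℤ (upTo (suc k)) (λ i → σP * σQ * (levelSum P i * levelSum Q (k ∸ i)))
    ≡⟨ sym (Σ-*ˡ (upTo (suc k)) (σP * σQ) (λ i → levelSum P i * levelSum Q (k ∸ i))) ⟩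
      σP * σQ * Σℤ (upTo (suc k)) (λ i → levelSum P i * levelSum Q (k ∸ i))
    ≡⟨ cong₂ _*_ (sym (ℤP.^-distribˡ-+-* (- + 1) (rankS P) (rankS Q))) (levelSum-convolution k) ⟩
      (- + 1) ^ rankS (P ×ᴾ Q) * pairSum k
    ∎
    where
    open ≡-Reasoning
    σP σQ : ℤ
    σP = (- + 1) ^ rankS P
    σQ = (- + 1) ^ rankS Q

proposition6p5 : (P Q : RawFinPoset) → IsRankedBoundedFinPoset P → IsRankedBoundedFinPoset Q →
    ∀ (k : ℕ) → Jcoeff (P ×ᴾ Q) k ≡ (Jcoeff P *ᵖ Jcoeff Q) k
proposition6p5 P Q isP isQ k = begin
    Jcoeff (P ×ᴾ Q) k
  ≡⟨ Jcoeff≡sign*levelSum (P ×ᴾ Q) k ⟩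
    (- + 1) ^ rankS (P ×ᴾ Q) * levelSum (P ×ᴾ Q) k
  ≡⟨ cong ((- + 1) ^ rankS (P ×ᴾ Q) *_) (levelSum-× k) ⟩
    (- + 1) ^ rankS (P ×ᴾ Q) * pairSum k
  ≡⟨ sym (*ᵖ-Jcoeff k) ⟩
    (Jcoeff P *ᵖ Jcoeff Q) k
  ∎
  where
  open Coefficients P Q isP isQ
  open ≡-Reasoning
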